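{- Let $G=(V,E)$ be an edge-weighted tree with distinct edge ranks, and let $D$ be its single-linkage dendrogram. Let $u\in V$, and let $e_1,e_2,\ldots,e_d$ be the edges incident to $u$, listed in increasing order of rank. Then $e_i\in\mathrm{spine}_D(e_1)$ for all $2\le i\le d$.
   Context: Let $G=(V,E)$ be a tree with real edge weights. Each edge $e$ has a rank $r_e$, its position when the edges are sorted by weight in increasing order with ties broken consistently, so ranks are distinct. The single-linkage dendrogram (SLD) $D$ of $G$ is defined by the following process. Start with every vertex in its own cluster, and process the edges in increasing order of rank; processing $e=(u,v)$ merges the current clusters of $u$ and $v$. $D$ is the rooted binary tree whose leaves are the vertices and whose internal nodes are the edges. The children of node $e$ are the nodes representing the two clusters merged when $e$ is processed: a leaf for a singleton cluster, and otherwise the edge whose processing created that cluster. For an edge $e$, $\mathrm{spine}_D(e)$ is the set of internal nodes on the path in $D$ from node $e$ to the root, including both $e$ and the root. -}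

module Defs where

open import Data.Nat using (ℕ; suc; _<_)
open import Data.Fin using (Fin; toℕ)
open import Data.Product using (_×_; _,_; Σ; ∃; proj₁; proj₂)
open import Data.Sum using (_⊎_)
open import Relation.Binary.PropositionalEquality using (_≡_)
open import Relation.Binary.Construct.Closure.ReflexiveTransitive using (Star)
open import Relation.Nullary using (¬_)

-- A graph on vertex set Fin n with m edges, listed IN INCREASING ORDER OF RANK:
-- edge i : Fin m has rank toℕ i (ranks distinct, ties already broken).
Edges : ℕ → ℕ → Set
Edges n m = Fin m → Fin n × Fin n

module _ {n m : ℕ} (E : Edges n m) where

  Joins : Fin m → Fin n → Fin n → Set
  Joins i x y = (E i ≡ (x , y)) ⊎ (E i ≡ (y , x))

  Incident : Fin n → Fin m → Set
  Incident u i = (proj₁ (E i) ≡ u) ⊎ (proj₂ (E i) ≡ u)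

  Adj : ℕ → Fin n → Fin n → Set
  Adj k x y = Σ (Fin m) λ i → (toℕ i < k) × Joins i x y

  -- x and y lie in the same cluster after processing all edges of rank < k
  Conn : ℕ → Fin n → Fin n → Set
  Conn k = Star (Adj k)

  IsTree : Set
  IsTree = (n ≡ suc m) × (∀ x y → Conn m x y)

  data Node : Set where
    leaf     : Fin n → Node
    internal : Fin m → Node

  -- ClusterNode k x c : c is the dendrogram node representing the cluster
  -- containing x after processing all edges of rank < k:
  -- the leaf x if that cluster is a singleton (no processed edge lies in it),
  -- otherwise the last processed edge lying in it (whose processing created it).
  data ClusterNode (k : ℕ) (x : Fin n) : Node → Set where
    singleton : (∀ j → toℕ j < k → ¬ Conn k x (proj₁ (E j))) →
                ClusterNode k x (leaf x)
    created   : ∀ j → toℕ j < k → Conn k x (proj₁ (E j)) →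
                (∀ j' → toℕ j < toℕ j' → toℕ j' < k → ¬ Conn k x (proj₁ (E j'))) →
                ClusterNode k x (internal j)

  -- c is a child of internal node e in D: c represents one of the two clusters
  -- merged when e is processed (i.e. the clusters, just before e, of e's endpoints)
  Child : Node → Fin m → Set
  Child c e = ClusterNode (toℕ e) (proj₁ (E e)) c ⊎ ClusterNode (toℕ e) (proj₂ (E e)) c

  Parent : Fin m → Fin m → Set
  Parent e f = Child (internal e) f

  InSpine : Fin m → Fin m → Set
  InSpine e f = Star Parent e f

{-# OPTIONS --safe #-}
-- Say that a touches f when, just before f is processed, the cluster of a
-- contains an endpoint p of f. Then f lies on the spine of a: the child c of f
-- on p's side is the highest-ranked edge of p's cluster, so either a = c, or
-- every edge of that cluster precedes c, hence a already touches c and we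
-- recurse on c. The theorem is the case a = e₁, f = e, p = u. Finding c needs
-- connectivity to be decidable.
module Submission where

open import Defs
open import Data.Nat as ℕ using (ℕ; zero; suc; _≤_; _<_; s≤s; s≤s⁻¹)
open import Data.Nat.Properties
  using (≤-refl; <-≤-trans; <⇒≱; ≮⇒≥; ≤∧≢⇒<; m<n⇒m<1+n; m<1+n⇒m<n∨m≡n; m≤n⇒m<n∨m≡n; n≤1+n)
open import Data.Fin as Fin using (Fin; toℕ; _≟_)
open import Data.Fin.Properties using (toℕ-injective; any?)
open import Data.Fin.Induction using (<-wellFounded)
open import Data.Product using (_×_; _,_; ∃; proj₁; proj₂; map₂)
open import Data.Sum as Sum using (_⊎_; inj₁; inj₂; [_,_]′)
open import Data.Empty using (⊥-elim)
open import Function using (_∘_)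
open import Induction.WellFounded using (Acc; acc)
open import Relation.Binary.PropositionalEquality using (_≡_; refl; sym; cong; subst)
open import Relation.Binary.Construct.Closure.ReflexiveTransitive
  using (ε; _◅_; _◅◅_; return; reverse)
import Relation.Binary.Construct.Closure.ReflexiveTransitive as Star
open import Relation.Nullary using (¬_; Dec; yes; no)
open import Relation.Nullary.Decidable using (_×-dec_; _⊎-dec_; map′)
open import Relation.Unary using (Pred; Decidable)

record GreatestBelow {m p} (P : Pred (Fin m) p) (b : ℕ) : Set p where
  field
    top      : Fin m
    top<b    : toℕ top < b
    holds    : P top
    greatest : ∀ j → toℕ top < toℕ j → toℕ j < b → ¬ P j

module _ {m p} {P : Pred (Fin m) p} (P? : Decidable P) where

  greatestBelow? : ∀ b → GreatestBelow P b ⊎ (∀ j → toℕ j < b → ¬ P j)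
  greatestBelow? zero = inj₂ (λ _ ())
  greatestBelow? (suc b) with any? (λ j → (toℕ j ℕ.≟ b) ×-dec P? j)
  ... | yes (j , refl , pj) = inj₁ record
    { top = j ; top<b = ≤-refl ; holds = pj
    ; greatest = λ _ j<i i<1+j _ → <⇒≱ j<i (s≤s⁻¹ i<1+j) }
  ... | no none-at-b = Sum.map extend (λ none j j<1+b pj → none j (below-b j j<1+b pj) pj)
                               (greatestBelow? b)
    where
      below-b : ∀ j → toℕ j < suc b → P j → toℕ j < b
      below-b j j<1+b pj with m<1+n⇒m<n∨m≡n j<1+b
      ... | inj₁ j<b  = j<b
      ... | inj₂ refl = ⊥-elim (none-at-b (j , refl , pj))

      extend : GreatestBelow P b → GreatestBelow P (suc b)
      extend g = record
        { top = top ; top<b = m<n⇒m<1+n top<b ; holds = holds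
        ; greatest = λ j t<j j<1+b pj → greatest j t<j (below-b j j<1+b pj) pj }
        where open GreatestBelow g

  greatestBelow : ∀ {a b} → P a → toℕ a < b → GreatestBelow P b
  greatestBelow pa a<b with greatestBelow? _
  ... | inj₁ g    = g
  ... | inj₂ none = ⊥-elim (none _ a<b pa)

top-maximal : ∀ {m p} {P : Pred (Fin m) p} {a b} (g : GreatestBelow P b) →
              P a → toℕ a < b → toℕ a ≤ toℕ (GreatestBelow.top g)
top-maximal g pa a<b = ≮⇒≥ (λ top<a → GreatestBelow.greatest g _ top<a a<b pa)

module _ {n m : ℕ} (E : Edges n m) where

  end₁ end₂ : Fin m → Fin n
  end₁ = proj₁ ∘ E
  end₂ = proj₂ ∘ E

  private
    variable
      k     : ℕ
      x y p : Fin n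
      e     : Fin m

  Adj-mono : ∀ {k k′} → k ≤ k′ → Adj E k x y → Adj E k′ x y
  Adj-mono k≤k′ (i , i<k , joins) = i , <-≤-trans i<k k≤k′ , joins

  Conn-suc : Conn E k x y → Conn E (suc k) x y
  Conn-suc = Star.map (Adj-mono (n≤1+n _))

  Adj-sym : Adj E k x y → Adj E k y x
  Adj-sym (i , i<k , inj₁ eq) = i , i<k , inj₂ eq
  Adj-sym (i , i<k , inj₂ eq) = i , i<k , inj₁ eq

  Conn-sym : Conn E k x y → Conn E k y x
  Conn-sym = reverse Adj-sym

  Conn-zero : Conn E 0 x y → x ≡ y
  Conn-zero ε                = refl
  Conn-zero ((_ , () , _) ◅ _)

  Joins⇒Incident : ∀ {i} → Joins E i x y → Incident E x i
  Joins⇒Incident (inj₁ eq) = inj₁ (cong proj₁ eq)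
  Joins⇒Incident (inj₂ eq) = inj₂ (cong proj₂ eq)

  Incident⇒Conn-end₁ : toℕ e < k → Incident E x e → Conn E k x (end₁ e)
  Incident⇒Conn-end₁ e<k (inj₁ refl) = ε
  Incident⇒Conn-end₁ e<k (inj₂ refl) = return (_ , e<k , inj₂ refl)

  Touches : ℕ → Fin n → Fin m → Set
  Touches k x e = Conn E k x (end₁ e) ⊎ Conn E k x (end₂ e)

  Conn⇒Touches : Conn E k x p → Incident E p e → Touches k x e
  Conn⇒Touches x⇝p (inj₁ refl) = inj₁ x⇝p
  Conn⇒Touches x⇝p (inj₂ refl) = inj₂ x⇝p

  Conn-◅◅-Touches : Conn E k x y → Touches k y e → Touches k x e
  Conn-◅◅-Touches x⇝y = Sum.map (x⇝y ◅◅_) (x⇝y ◅◅_)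

  Touches⇒Conn-end₁ : Touches (toℕ e) x e → Conn E (suc (toℕ e)) x (end₁ e)
  Touches⇒Conn-end₁     (inj₁ x⇝e₁) = Conn-suc x⇝e₁
  Touches⇒Conn-end₁ {e} (inj₂ x⇝e₂) = Conn-suc x⇝e₂ ◅◅ return (e , ≤-refl , inj₂ refl)

  first-crossing : Conn E (suc k) x y → Conn E k x y ⊎ ∃ λ e → toℕ e ≡ k × Touches k x e
  first-crossing ε = inj₁ ε
  first-crossing ((i , i<1+k , joins) ◅ rest) with m<1+n⇒m<n∨m≡n i<1+k
  ... | inj₂ refl = inj₂ (i , refl , Conn⇒Touches ε (Joins⇒Incident joins))
  ... | inj₁ i<k  = Sum.map (step ◅_) (map₂ (map₂ (Conn-◅◅-Touches (return step))))
                            (first-crossing rest)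
    where step = i , i<k , joins

  Conn-end₁⇒Touches : Conn E (suc (toℕ e)) x (end₁ e) → Touches (toℕ e) x e
  Conn-end₁⇒Touches x⇝e₁ with first-crossing x⇝e₁
  ... | inj₁ x⇝e₁′ = inj₁ x⇝e₁′
  ... | inj₂ (e′ , e′≡e , touches) with toℕ-injective e′≡e
  ...   | refl = touches

  Bridged : ℕ → Fin n → Fin n → Set
  Bridged k x y = ∃ λ e → toℕ e ≡ k × Touches k x e × Touches k y e

  Conn-suc⇒Conn⊎Bridged : Conn E (suc k) x y → Conn E k x y ⊎ Bridged k x y
  Conn-suc⇒Conn⊎Bridged x⇝y with first-crossing x⇝y | first-crossing (Conn-sym x⇝y)
  ... | inj₁ x⇝y′ | _         = inj₁ x⇝y′
  ... | inj₂ _    | inj₁ y⇝x′ = inj₁ (Conn-sym y⇝x′)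
  ... | inj₂ (e , refl , tx) | inj₂ (e′ , e′≡e , ty) with toℕ-injective e′≡e
  ...   | refl = inj₂ (e , refl , tx , ty)

  Bridged⇒Conn-suc : Bridged k x y → Conn E (suc k) x y
  Bridged⇒Conn-suc (e , refl , tx , ty) = Touches⇒Conn-end₁ tx ◅◅ Conn-sym (Touches⇒Conn-end₁ ty)

  Conn? : ∀ k x y → Dec (Conn E k x y)
  Conn? zero    x y = map′ (λ { refl → ε }) Conn-zero (x ≟ y)
  Conn? (suc k) x y = map′ [ Conn-suc , Bridged⇒Conn-suc ]′ Conn-suc⇒Conn⊎Bridged
                           (Conn? k x y ⊎-dec Bridged?)
    where
      Touches? : ∀ z e → Dec (Touches k z e)
      Touches? z e = Conn? k z (end₁ e) ⊎-dec Conn? k z (end₂ e)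
      Bridged? : Dec (Bridged k x y)
      Bridged? = any? (λ e → (toℕ e ℕ.≟ k) ×-dec (Touches? x e ×-dec Touches? y e))

  Conn-end₁-of-step : ∀ {z} → Conn E k x y → (step : Adj E k y z) → Conn E k x (end₁ (proj₁ step))
  Conn-end₁-of-step x⇝y (i , _ , inj₁ eq) = subst (Conn E _ _) (sym (cong proj₁ eq)) x⇝y
  Conn-end₁-of-step x⇝y step@(i , _ , inj₂ eq) =
    subst (Conn E _ _) (sym (cong proj₁ eq)) (x⇝y ◅◅ return step)

  Conn-restrict : ∀ {f} → (∀ j → toℕ j < f → Conn E f x (end₁ j) → toℕ j < k) →
                  Conn E f x y → Conn E k x y
  Conn-restrict {x = x} {k = k} {f = f} bound = go ε
    where
      go : ∀ {w z} → Conn E f x w → Conn E f w z → Conn E k w z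
      go x⇝w ε = ε
      go x⇝w (step@(i , i<f , joins) ◅ rest) =
        (i , bound i i<f (Conn-end₁-of-step x⇝w step) , joins) ◅ go (x⇝w ◅◅ return step) rest

  Touches⇒InSpine : ∀ {f} → Acc Fin._<_ f → ∀ {a} → toℕ a < toℕ f →
                    Touches (toℕ f) (end₁ a) f → InSpine E a f
  Touches⇒InSpine {f} (acc smaller) {a} a<f =
    [ (λ a⇝e₁ → via-endpoint a⇝e₁ inj₁) , (λ a⇝e₂ → via-endpoint a⇝e₂ inj₂) ]′
    where
      via-endpoint : Conn E (toℕ f) (end₁ a) p →
                     (∀ {c} → ClusterNode E (toℕ f) p c → Child E c f) → InSpine E a f
      via-endpoint {p} a⇝p child = by-cases (m≤n⇒m<n∨m≡n (top-maximal cluster p⇝a a<f))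
        where
          p⇝a : Conn E (toℕ f) p (end₁ a)
          p⇝a = Conn-sym a⇝p

          cluster : GreatestBelow (λ j → Conn E (toℕ f) p (end₁ j)) (toℕ f)
          cluster = greatestBelow (λ j → Conn? (toℕ f) p (end₁ j)) p⇝a a<f
          open GreatestBelow cluster renaming (top to c; top<b to c<f; holds to p⇝c)

          parent : Parent E c f
          parent = child (created c c<f p⇝c greatest)

          within-c : Conn E (toℕ f) p y → Conn E (suc (toℕ c)) p y
          within-c = Conn-restrict (λ j j<f p⇝j → s≤s (top-maximal cluster p⇝j j<f))

          by-cases : toℕ a < toℕ c ⊎ toℕ a ≡ toℕ c → InSpine E a f
          by-cases (inj₁ a<c) =
            Touches⇒InSpine (smaller c<f) a<c
              (Conn-end₁⇒Touches (Conn-sym (within-c p⇝a) ◅◅ within-c p⇝c))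
            ◅◅ return parent
          by-cases (inj₂ a≡c) =
            subst (λ a′ → InSpine E a′ f) (sym (toℕ-injective a≡c)) (return parent)

lemma3p3 : {n m : ℕ} (E : Edges n m) → IsTree E → (u : Fin n) →
           (e₁ : Fin m) → Incident E u e₁ →
           (∀ f → Incident E u f → toℕ e₁ ≤ toℕ f) →
           (e : Fin m) → Incident E u e → ¬ (e ≡ e₁) →
           InSpine E e₁ e
lemma3p3 E _ _ e₁ u∈e₁ e₁-first e u∈e e≢e₁ =
  Touches⇒InSpine E (<-wellFounded e) e₁<e
    (Conn⇒Touches E (Conn-sym E (Incident⇒Conn-end₁ E e₁<e u∈e₁)) u∈e)
  where
    e₁<e : toℕ e₁ < toℕ e
    e₁<e = ≤∧≢⇒< (e₁-first e u∈e) (e≢e₁ ∘ sym ∘ toℕ-injective)
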